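{- If $H$ is a graph with a conical vertex and $|H|\geq 3$, then for any integer $t\geq e(H)$, \[\operatorname{sat}_t(n,\mathfrak{R}(H))\geq \left(\frac{1}{4t^2}+o(1)\right)n\log n \quad (n\to\infty).\]
   Context: A $t$-edge-coloured graph is a graph $G$ with a function $c:E(G)\to\{1,\dots,t\}$ (not necessarily proper). A copy of $H$ is rainbow if all its edges receive distinct colours; $\mathfrak{R}(H)$ denotes the family of rainbow copies of $H$. A $t$-edge-coloured graph is $\mathfrak{R}(H)$-saturated if it contains no rainbow copy of $H$ but adding any non-edge in any colour from $\{1,\dots,t\}$ creates a rainbow copy of $H$. $\operatorname{sat}_t(n,\mathfrak{R}(H))$ is the minimum number of edges of such a graph on $n$ vertices. A vertex of $H$ is conical if its degree is $|H|-1$. Logarithms are base 2. -}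

module Defs where

open import Data.Nat using (ℕ; _<_; _≤_)
open import Data.Nat.Properties using (_<?_)
open import Data.Fin using (Fin; toℕ; _≟_)
open import Data.Bool using (Bool; true; false; T; if_then_else_; _∧_; _∨_)
open import Data.Maybe using (Maybe; just; nothing; is-just)
open import Data.List using (List; length; filter; concatMap; map; allFin)
open import Data.Product using (_×_; _,_; proj₁; proj₂; ∃; ∃-syntax)
open import Data.Sum using (_⊎_)
open import Relation.Nullary using (¬_; does; Dec)
open import Relation.Nullary.Decidable using (_×-dec_; T?)
open import Relation.Binary.PropositionalEquality using (_≡_; _≢_)
open import Function.Definitions using (Injective)

record SimpleGraph (k : ℕ) : Set where
  field
    adj    : Fin k → Fin k → Bool
    sym    : ∀ u v → adj u v ≡ adj v u
    irrefl : ∀ u → adj u u ≡ false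
open SimpleGraph public

pairs : (n : ℕ) → List (Fin n × Fin n)
pairs n = concatMap (λ i → map (i ,_) (allFin n)) (allFin n)

countPairs : (n : ℕ) → (Fin n → Fin n → Bool) → ℕ
countPairs n P = length (filter dec (pairs n))
  where
    dec : (p : Fin n × Fin n) → Dec ((toℕ (proj₁ p) < toℕ (proj₂ p)) × T (P (proj₁ p) (proj₂ p)))
    dec (i , j) = (toℕ i <? toℕ j) ×-dec T? (P i j)

eH : ∀ {k} → SimpleGraph k → ℕ
eH {k} H = countPairs k (adj H)

HasConicalVertex : ∀ {k} → SimpleGraph k → Set
HasConicalVertex {k} H = ∃[ v ] (∀ u → u ≢ v → adj H v u ≡ true)

-- t-edge-coloured graphs on vertex set Fin n.
-- col i j = nothing  : ij is a non-edge;  col i j = just c : ij is an edge of colour c.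

Colouring : ℕ → ℕ → Set
Colouring n t = Fin n → Fin n → Maybe (Fin t)

record ColGraph (n t : ℕ) : Set where
  field
    col    : Colouring n t
    sym    : ∀ i j → col i j ≡ col j i
    irrefl : ∀ i → col i i ≡ nothing
open ColGraph public

eG : ∀ {n t} → ColGraph n t → ℕ
eG {n} G = countPairs n (λ i j → is-just (col G i j))

RainbowCopy : ∀ {k n t} → SimpleGraph k → Colouring n t → Set
RainbowCopy {k} {n} {t} H c =
  ∃[ φ ] ( Injective _≡_ _≡_ φ
         × (∀ u v → adj H u v ≡ true → ∃[ a ] (c (φ u) (φ v) ≡ just a))
         × (∀ u v u' v' → adj H u v ≡ true → adj H u' v' ≡ true
              → c (φ u) (φ v) ≡ c (φ u') (φ v')
              → (u ≡ u' × v ≡ v') ⊎ (u ≡ v' × v ≡ u')) )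

addEdge : ∀ {n t} → Colouring n t → Fin n → Fin n → Fin t → Colouring n t
addEdge c i j a x y =
  if (does (x ≟ i) ∧ does (y ≟ j)) ∨ (does (x ≟ j) ∧ does (y ≟ i))
  then just a else c x y

Saturated : ∀ {k n t} → SimpleGraph k → ColGraph n t → Set
Saturated H G =
  ¬ RainbowCopy H (col G)
  × (∀ i j → i ≢ j → col G i j ≡ nothing → ∀ a → RainbowCopy H (addEdge (col G) i j a))

module Submission where

open import Algebra.Properties.CommutativeSemigroup using (interchange)
open import Data.Bool using (Bool; true; false; _∧_; not)
import Data.Bool.Properties as Bool
open import Data.Empty using (⊥-elim)
open import Data.Fin using (Fin; zero; suc; _≟_; toℕ; fromℕ; inject₁)
import Data.Fin.Properties as Fin
open import Data.List using (List; []; _∷_; _++_; length; filter; map; concatMap; tabulate)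
open import Data.List.Properties using (map-tabulate)
open import Data.Maybe using (Maybe; just; nothing; is-just; is-nothing)
import Data.Maybe as Maybe
open import Data.Nat using (ℕ; zero; suc; _+_; _*_; _^_; _∸_; _≤_; z≤n; s≤s; _≤?_; _≤ᵇ_; >-nonZero)
open import Data.Nat.Properties hiding (_≟_)
open import Data.Nat.Solver using (module +-*-Solver)
open import Data.Product using (_×_; _,_; proj₁; proj₂; ∃; ∃-syntax)
open import Data.Sum using (_⊎_; inj₁; inj₂)
open import Function using (_∘_)
open import Function.Definitions using (Injective)
open import Level using (0ℓ)
open import Relation.Binary.Definitions using (tri<; tri≈; tri>)
open import Relation.Binary.PropositionalEquality
open import Relation.Nullary using (does; yes; no; ¬_)
open import Relation.Nullary.Decidable using (dec-true; dec-false; _×-dec_; ¬?)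
open import Relation.Nullary.Reflects using (ofʸ; ofⁿ)
open import Relation.Unary using (Pred; Decidable)
open import Algebra.Properties.Semiring.Sum +-*-semiring
  using (sum; sum-syntax; sum-cong-≗; sum-replicate-zero; ∑-distrib-+; ∑-comm; *-distribˡ-sum; *-distribʳ-sum)
open import Defs hiding (sym; irrefl)

-- The paper's bound e(G) ≥ (1/(4t²) + o(1)) n log n is proved in the exponentiated form
-- n ^ ((m - 4t²) n) ≤ 2 ^ (4t² m e(G)) for every n ≥ N = 2 ^ ((3t + 2t²) m).
--
-- Idea.  Every vertex u sees some colour (one of its edges has it, or u is isolated).  Encode u by
-- the partial word code u of length n over t + 1 letters recording the colour of each edge uz, plus
-- a fresh letter at position u.  Two vertices seeing the same colour a have conflicting words
-- (different letters at a common position): if uv ∉ G, saturation gives a rainbow copy of H in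
-- G + uv (colour a) through uv; since H has a conical vertex the edge of H sent to uv lies in a
-- triangle, whose apex is a common neighbour joined to u and v in different colours, or it is a
-- pendant edge at a conical vertex, and re-routing it along an a-coloured edge at u would give a
-- rainbow copy inside G.  The s ≥ n / t vertices seeing the most popular colour therefore satisfy
-- Kraft's inequality, which forces s ^ s ≤ 4 ^ s (t + 1) ^ (2X) for their total number of letters
-- X ≤ n + 2 e(G); the rest is arithmetic.

𝟙 : Bool → ℕ
𝟙 true  = 1
𝟙 false = 0

𝟙-*-≤ : ∀ b x → 𝟙 b * x ≤ x
𝟙-*-≤ true  x = ≤-reflexive (+-identityʳ x)
𝟙-*-≤ false x = z≤n

𝟙-∧-≤ : ∀ a b x → 𝟙 (a ∧ b) * x ≤ 𝟙 a * x
𝟙-∧-≤ true  b x = ≤-trans (𝟙-*-≤ b x) (m≤m+n x 0)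
𝟙-∧-≤ false b x = z≤n

𝟙-split : ∀ a b → 𝟙 (a ∧ b) + 𝟙 (a ∧ not b) ≡ 𝟙 a
𝟙-split true  true  = refl
𝟙-split true  false = refl
𝟙-split false b     = refl

𝟙-∧ : ∀ a b x → 𝟙 a * (𝟙 b * x) ≡ 𝟙 (a ∧ b) * x
𝟙-∧ true  b x = +-identityʳ (𝟙 b * x)
𝟙-∧ false b x = refl

count : ∀ {N} → (Fin N → Bool) → ℕ
count P = ∑[ i < _ ] 𝟙 (P i)

sum-mono : ∀ {n} (f g : Fin n → ℕ) → (∀ i → f i ≤ g i) → sum f ≤ sum g
sum-mono {zero}  f g f≤g = z≤n
sum-mono {suc n} f g f≤g = +-mono-≤ (f≤g zero) (sum-mono (f ∘ suc) (g ∘ suc) (f≤g ∘ suc))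

term≤sum : ∀ {n} (f : Fin n → ℕ) i → f i ≤ sum f
term≤sum f zero    = m≤m+n (f zero) _
term≤sum f (suc i) = ≤-trans (term≤sum (f ∘ suc) i) (m≤n+m _ (f zero))

sum-const : ∀ n c → ∑[ i < n ] c ≡ n * c
sum-const zero    c = refl
sum-const (suc n) c = cong (c +_) (sum-const n c)

count-≡ : ∀ {n} (u : Fin n) → count (λ z → does (z ≟ u)) ≡ 1
count-≡ {suc n} zero    = cong suc (sum-replicate-zero n)
count-≡ {suc n} (suc u) = trans (sum-cong-≗ shift) (count-≡ u)
  where
  shift : ∀ z → 𝟙 (does (suc z ≟ suc u)) ≡ 𝟙 (does (z ≟ u))
  shift z with z ≟ u
  ... | yes _ = refl
  ... | no  _ = refl

count≤ : ∀ {n} (P : Fin n → Bool) → count P ≤ n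
count≤ {n} P =
  ≤-trans (sum-mono _ (λ _ → 1) (λ i → 𝟙-≤1 (P i))) (≤-reflexive (trans (sum-const n 1) (*-identityʳ n)))
  where
  𝟙-≤1 : ∀ b → 𝟙 b ≤ 1
  𝟙-≤1 true  = ≤-refl
  𝟙-≤1 false = z≤n

count-≤1 : ∀ {n} (P : Fin n → Bool) → (∀ i j → P i ≡ true → P j ≡ true → i ≡ j) → count P ≤ 1
count-≤1 {zero}  P unique = z≤n
count-≤1 {suc n} P unique with P zero in P₀
... | true  = ≤-reflexive (cong suc (trans (sum-cong-≗ none) (sum-replicate-zero n)))
  where
  none : ∀ i → 𝟙 (P (suc i)) ≡ 0
  none i with P (suc i) in Pᵢ
  ... | true  with () ← unique zero (suc i) P₀ Pᵢ
  ... | false = refl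
... | false = count-≤1 (P ∘ suc) (λ i j Pᵢ Pⱼ → Fin.suc-injective (unique (suc i) (suc j) Pᵢ Pⱼ))

argmax : ∀ {t} (g : Fin (suc t) → ℕ) → ∃[ a ] (∀ c → g c ≤ g a)
argmax {zero}  g = zero , λ { zero → ≤-refl }
argmax {suc t} g with argmax (g ∘ suc)
... | a , max with g zero ≤? g (suc a)
...   | yes g₀≤ = suc a , λ { zero → g₀≤ ; (suc c) → max c }
...   | no  g₀≰ = zero  , λ { zero → ≤-refl ; (suc c) → ≤-trans (max c) (<⇒≤ (≰⇒> g₀≰)) }

pigeonhole : ∀ {n t} (f : Fin n → Fin (suc t)) → ∃[ a ] (n ≤ suc t * count (λ u → does (a ≟ f u)))
pigeonhole {n} {t} f = a , (begin
  n                                           ≡⟨ *-identityʳ n ⟨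
  n * 1                                       ≡⟨ sum-const n 1 ⟨
  ∑[ u < n ] 1                                ≡⟨ sum-cong-≗ (λ u → count-≡ (f u)) ⟨
  ∑[ u < n ] count (λ c → does (c ≟ f u))     ≡⟨ ∑-comm (λ u c → 𝟙 (does (c ≟ f u))) ⟩
  ∑[ c < suc t ] size c                       ≤⟨ sum-mono size (λ _ → size a) max ⟩
  ∑[ c < suc t ] size a                       ≡⟨ sum-const (suc t) (size a) ⟩
  suc t * size a                              ∎)
  where
  open ≤-Reasoning
  size : Fin (suc t) → ℕ
  size c = count (λ u → does (c ≟ f u))
  a : Fin (suc t)
  a = proj₁ (argmax size)
  max : ∀ c → size c ≤ size a
  max = proj₂ (argmax size)

module _ {A : Set} {Q : Pred A 0ℓ} (Q? : Decidable Q) where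

  length-filter-++ : ∀ xs ys → length (filter Q? (xs ++ ys)) ≡ length (filter Q? xs) + length (filter Q? ys)
  length-filter-++ []       ys = refl
  length-filter-++ (x ∷ xs) ys with does (Q? x)
  ... | true  = cong suc (length-filter-++ xs ys)
  ... | false = length-filter-++ xs ys

  length-filter-concatMap : ∀ {B : Set} {n} (f : B → List A) (g : Fin n → B) →
    length (filter Q? (concatMap f (tabulate g))) ≡ ∑[ i < n ] length (filter Q? (f (g i)))
  length-filter-concatMap {n = zero}  f g = refl
  length-filter-concatMap {n = suc n} f g =
    trans (length-filter-++ (f (g zero)) _) (cong (_ +_) (length-filter-concatMap f (g ∘ suc)))

  length-filter-tabulate : ∀ {n} (g : Fin n → A) →
    length (filter Q? (tabulate g)) ≡ ∑[ j < n ] 𝟙 (does (Q? (g j)))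
  length-filter-tabulate {zero}  g = refl
  length-filter-tabulate {suc n} g with does (Q? (g zero))
  ... | true  = cong suc (length-filter-tabulate (g ∘ suc))
  ... | false = length-filter-tabulate (g ∘ suc)

length-filter-pairs : ∀ {n} {Q : Pred (Fin n × Fin n) 0ℓ} (Q? : Decidable Q) →
  length (filter Q? (pairs n)) ≡ ∑[ i < n ] ∑[ j < n ] 𝟙 (does (Q? (i , j)))
length-filter-pairs {n} Q? =
  trans (length-filter-concatMap Q? (λ i → map (i ,_) (tabulate (λ j → j))) (λ i → i))
        (sum-cong-≗ (λ i → trans (cong (length ∘ filter Q?) (map-tabulate (λ j → j) (i ,_)))
                                  (length-filter-tabulate Q? (λ j → (i , j)))))

countPairs-sum : ∀ n (E : Fin n → Fin n → Bool) →
  countPairs n E ≡ ∑[ i < n ] ∑[ j < n ] 𝟙 (does (toℕ i <? toℕ j) ∧ E i j)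
countPairs-sum n E = length-filter-pairs {n} _

handshake : ∀ n (E : Fin n → Fin n → Bool) → (∀ i j → E i j ≡ E j i) → (∀ i → E i i ≡ false) →
  ∑[ i < n ] ∑[ j < n ] 𝟙 (E i j) ≡ 2 * countPairs n E
handshake n E E-sym E-irrefl = begin
  ∑[ i < n ] ∑[ j < n ] 𝟙 (E i j)                       ≡⟨ sum-cong-≗ (λ i → sum-cong-≗ (split i)) ⟩
  ∑[ i < n ] ∑[ j < n ] (below i j + below j i)         ≡⟨ sum-cong-≗ (λ i → ∑-distrib-+ (below i) (λ j → below j i)) ⟩
  ∑[ i < n ] (C i + ∑[ j < n ] below j i)                ≡⟨ ∑-distrib-+ C (λ i → ∑[ j < n ] below j i) ⟩
  sum C + ∑[ i < n ] ∑[ j < n ] below j i                ≡⟨ cong (sum C +_) (∑-comm (λ i j → below j i)) ⟩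
  sum C + sum C                                         ≡⟨ cong (sum C +_) (sym (+-identityʳ (sum C))) ⟩
  2 * sum C                                             ≡⟨ cong (2 *_) (sym (countPairs-sum n E)) ⟩
  2 * countPairs n E                                    ∎
  where
  open ≡-Reasoning
  below : Fin n → Fin n → ℕ
  below i j = 𝟙 (does (toℕ i <? toℕ j) ∧ E i j)
  C : Fin n → ℕ
  C i = ∑[ j < n ] below i j
  split : ∀ i j → 𝟙 (E i j) ≡ below i j + below j i
  split i j with Fin.<-cmp i j
  ... | tri< i<j _ _ rewrite dec-true (toℕ i <? toℕ j) i<j | dec-false (toℕ j <? toℕ i) (<-asym i<j)
    = sym (+-identityʳ _)
  ... | tri> _ _ j<i rewrite dec-false (toℕ i <? toℕ j) (<-asym j<i) | dec-true (toℕ j <? toℕ i) j<i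
    = cong 𝟙 (E-sym i j)
  ... | tri≈ _ refl _ rewrite dec-false (toℕ i <? toℕ i) (<-irrefl refl) | E-irrefl i = refl

Word : ℕ → ℕ → Set
Word n q = Fin n → Maybe (Fin q)

Conflict : ∀ {n q} → Word n q → Word n q → Set
Conflict w w′ = ∃[ z ] ∃[ x ] ∃[ y ] (w z ≡ just x × w′ z ≡ just y × x ≢ y)

blanks letters : ∀ {n q} → Word n q → ℕ
blanks  {n} w = ∑[ z < n ] 𝟙 (is-nothing (w z))
letters {n} w = ∑[ z < n ] 𝟙 (is-just (w z))

blanks+letters : ∀ {n q} (w : Word n q) → blanks w + letters w ≡ n
blanks+letters {n} w = begin
  blanks w + letters w                                       ≡⟨ ∑-distrib-+ (λ z → 𝟙 (is-nothing (w z))) _ ⟨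
  ∑[ z < n ] (𝟙 (is-nothing (w z)) + 𝟙 (is-just (w z)))      ≡⟨ sum-cong-≗ (one ∘ w) ⟩
  ∑[ z < n ] 1                                               ≡⟨ sum-const n 1 ⟩
  n * 1                                                      ≡⟨ *-identityʳ n ⟩
  n                                                          ∎
  where
  open ≡-Reasoning
  one : ∀ {A : Set} (m : Maybe A) → 𝟙 (is-nothing m) + 𝟙 (is-just m) ≡ 1
  one nothing  = refl
  one (just _) = refl

fits : ∀ {q} → Fin q → Maybe (Fin q) → Bool
fits c nothing  = true
fits c (just x) = does (c ≟ x)

fits-just : ∀ {q} {c x : Fin q} → fits c (just x) ≡ true → c ≡ x
fits-just {c = c} {x} fits-cx with c ≟ x
... | yes c≡x = c≡x

count-fits : ∀ {q} (m : Maybe (Fin q)) → count (λ c → fits c m) ≡ q ^ 𝟙 (is-nothing m)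
count-fits {q} nothing  = sum-const q 1
count-fits     (just x) = count-≡ x

-- Kraft's inequality: a partial word with b blanks has q ^ b completions, and pairwise
-- conflicting partial words have disjoint sets of completions.
kraft : ∀ {q N} n (F : Fin N → Word n q) (P : Fin N → Bool)
  → (∀ i j → P i ≡ true → P j ≡ true → i ≢ j → Conflict (F i) (F j))
  → ∑[ i < N ] (𝟙 (P i) * q ^ blanks (F i)) ≤ q ^ n
kraft {q} {N} zero F P conflicting = begin
  ∑[ i < N ] (𝟙 (P i) * 1)   ≡⟨ sum-cong-≗ (λ i → *-identityʳ (𝟙 (P i))) ⟩
  count P                    ≤⟨ count-≤1 P unique ⟩
  1                          ∎
  where
  open ≤-Reasoning
  unique : ∀ i j → P i ≡ true → P j ≡ true → i ≡ j
  unique i j Pᵢ Pⱼ with i ≟ j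
  ... | yes i≡j = i≡j
  ... | no  i≢j with () , _ ← conflicting i j Pᵢ Pⱼ i≢j
kraft {q} {N} (suc n) F P conflicting = begin
  ∑[ i < N ] (𝟙 (P i) * q ^ blanks (F i))               ≡⟨ sum-cong-≗ split ⟩
  ∑[ i < N ] ∑[ c < q ] (𝟙 (Pᶜ c i) * q ^ blanks (F′ i))  ≡⟨ ∑-comm (λ i c → 𝟙 (Pᶜ c i) * q ^ blanks (F′ i)) ⟩
  ∑[ c < q ] ∑[ i < N ] (𝟙 (Pᶜ c i) * q ^ blanks (F′ i))  ≤⟨ sum-mono _ _ (λ c → kraft n F′ (Pᶜ c) (conflictingᶜ c)) ⟩
  ∑[ c < q ] (q ^ n)                                    ≡⟨ sum-const q (q ^ n) ⟩
  q ^ suc n                                             ∎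
  where
  open ≤-Reasoning
  F′ : Fin N → Word n q
  F′ i = F i ∘ suc
  Pᶜ : Fin q → Fin N → Bool
  Pᶜ c i = P i ∧ fits c (F i zero)
  split : ∀ i → 𝟙 (P i) * q ^ blanks (F i) ≡ ∑[ c < q ] (𝟙 (Pᶜ c i) * q ^ blanks (F′ i))
  split i = let m = F i zero ; b = blanks (F′ i) in ≡.begin
    𝟙 (P i) * q ^ (𝟙 (is-nothing m) + b)           ≡.≡⟨ cong (𝟙 (P i) *_) (^-distribˡ-+-* q (𝟙 (is-nothing m)) b) ⟩
    𝟙 (P i) * (q ^ 𝟙 (is-nothing m) * q ^ b)       ≡.≡⟨ cong (λ k → 𝟙 (P i) * (k * q ^ b)) (count-fits m) ⟨
    𝟙 (P i) * (count (λ c → fits c m) * q ^ b)     ≡.≡⟨ cong (𝟙 (P i) *_) (*-distribʳ-sum (q ^ b) (λ c → 𝟙 (fits c m))) ⟩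
    𝟙 (P i) * ∑[ c < q ] (𝟙 (fits c m) * q ^ b)    ≡.≡⟨ *-distribˡ-sum (𝟙 (P i)) (λ c → 𝟙 (fits c m) * q ^ b) ⟩
    ∑[ c < q ] (𝟙 (P i) * (𝟙 (fits c m) * q ^ b))  ≡.≡⟨ sum-cong-≗ (λ c → 𝟙-∧ (P i) (fits c m) (q ^ b)) ⟩
    ∑[ c < q ] (𝟙 (Pᶜ c i) * q ^ b)                ≡.∎
    where module ≡ = ≡-Reasoning
  conflictingᶜ : ∀ c i j → Pᶜ c i ≡ true → Pᶜ c j ≡ true → i ≢ j → Conflict (F′ i) (F′ j)
  conflictingᶜ c i j Pᶜi Pᶜj i≢j with conflicting i j (Bool.∧-conicalˡ (P i) _ Pᶜi) (Bool.∧-conicalˡ (P j) _ Pᶜj) i≢j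
  ... | suc z , conflict = z , conflict
  ... | zero  , x , y , Fi₀ , Fj₀ , x≢y = ⊥-elim (x≢y (trans (sym (first-letter Pᶜi Fi₀)) (first-letter Pᶜj Fj₀)))
    where
    first-letter : ∀ {i x} → Pᶜ c i ≡ true → F i zero ≡ just x → c ≡ x
    first-letter {i} Pᶜi F₀ = fits-just (subst (λ m → fits c m ≡ true) F₀ (Bool.∧-conicalʳ (P i) _ Pᶜi))

power-bound : ∀ {N} (P : Fin N → Bool) (f : Fin N → ℕ) {s c q} →
  (∀ i → P i ≡ true → s ≤ c * q ^ f i) →
  s ^ count P ≤ c ^ count P * q ^ ∑[ i < N ] (𝟙 (P i) * f i)
power-bound {zero}  P f bound = ≤-refl
power-bound {suc N} P f {s} {c} {q} bound with P zero in P₀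
... | false = power-bound (P ∘ suc) (f ∘ suc) (bound ∘ suc)
... | true  = begin
  s * s ^ g                        ≤⟨ *-mono-≤ (bound zero P₀) (power-bound (P ∘ suc) (f ∘ suc) (bound ∘ suc)) ⟩
  (c * q ^ f₀) * (c ^ g * q ^ X)   ≡⟨ interchange *-commutativeSemigroup c (q ^ f₀) (c ^ g) (q ^ X) ⟩
  c ^ suc g * (q ^ f₀ * q ^ X)     ≡⟨ cong (λ e → c ^ suc g * (q ^ e * q ^ X)) (+-identityʳ f₀) ⟨
  c ^ suc g * (q ^ (f₀ + 0) * q ^ X) ≡⟨ cong (c ^ suc g *_) (^-distribˡ-+-* q (f₀ + 0) X) ⟨
  c ^ suc g * q ^ (f₀ + 0 + X)     ∎
  where
  open ≤-Reasoning
  f₀ g X : ℕ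
  f₀ = f zero
  g = count (P ∘ suc)
  X = ∑[ i < N ] (𝟙 (P (suc i)) * f (suc i))

^-distribʳ-* : ∀ a b k → (a * b) ^ k ≡ a ^ k * b ^ k
^-distribʳ-* a b zero    = refl
^-distribʳ-* a b (suc k) = trans (cong (a * b *_) (^-distribʳ-* a b k)) (interchange *-commutativeSemigroup a b (a ^ k) (b ^ k))

suc≤2^ : ∀ t → suc t ≤ 2 ^ t
suc≤2^ zero    = ≤-refl
suc≤2^ (suc t) = +-mono-≤ (m^n>0 2 t) (≤-trans (suc≤2^ t) (m≤m+n (2 ^ t) 0))

-- Squaring a bound for at least half of the s factors of s ^ s.
doubling-bound : ∀ {s g B} → s ≤ 2 * g → g ≤ s → s ^ g ≤ 2 ^ g * B → s ^ s ≤ 2 ^ (2 * s) * B ^ 2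
doubling-bound {zero} {B = zero}  _ z≤n ()
doubling-bound {zero} {B = suc b} _ z≤n _ = ≤-trans (m^n>0 (suc b) 2) (≤-reflexive (sym (+-identityʳ _)))
doubling-bound {s@(suc _)} {g} {B} s≤2g g≤s product = begin
  s ^ s                 ≤⟨ ^-monoʳ-≤ s s≤2g ⟩
  s ^ (2 * g)           ≡⟨ cong (s ^_) (*-comm 2 g) ⟩
  s ^ (g * 2)           ≡⟨ ^-*-assoc s g 2 ⟨
  (s ^ g) ^ 2           ≤⟨ ^-monoˡ-≤ 2 product ⟩
  (2 ^ g * B) ^ 2       ≡⟨ ^-distribʳ-* (2 ^ g) B 2 ⟩
  (2 ^ g) ^ 2 * B ^ 2   ≡⟨ cong (_* B ^ 2) (trans (^-*-assoc 2 g 2) (cong (2 ^_) (*-comm g 2))) ⟩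
  2 ^ (2 * g) * B ^ 2   ≤⟨ *-monoˡ-≤ (B ^ 2) (^-monoʳ-≤ 2 (*-monoʳ-≤ 2 g≤s)) ⟩
  2 ^ (2 * s) * B ^ 2   ∎
  where open ≤-Reasoning

-- At most half of the selected words are poor (2 q ^ letters < s), since each of those
-- takes more than a 2/s share of the Kraft sum; and each rich word contributes a factor
-- s ≤ 2 q ^ letters.
entropy-bound : ∀ {r N n} (F : Fin N → Word n (suc r)) (P : Fin N → Bool) →
  ∑[ i < N ] (𝟙 (P i) * suc r ^ blanks (F i)) ≤ suc r ^ n →
  count P ^ count P ≤ 2 ^ (2 * count P) * suc r ^ (2 * ∑[ i < N ] (𝟙 (P i) * letters (F i)))
entropy-bound {r} {N} {n} F P kraft-bound = bound
  where
  q s X : ℕ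
  q = suc r
  s = count P
  X = ∑[ i < N ] (𝟙 (P i) * letters (F i))
  rich poor : Fin N → Bool
  rich i = P i ∧ (s ≤ᵇ 2 * q ^ letters (F i))
  poor i = P i ∧ not (s ≤ᵇ 2 * q ^ letters (F i))

  rich+poor : count rich + count poor ≡ s
  rich+poor = trans (sym (∑-distrib-+ (𝟙 ∘ rich) (𝟙 ∘ poor)))
                    (sum-cong-≗ (λ i → 𝟙-split (P i) (s ≤ᵇ 2 * q ^ letters (F i))))

  q^n-split : ∀ i → q ^ n ≡ q ^ letters (F i) * q ^ blanks (F i)
  q^n-split i = begin
    q ^ n                                  ≡⟨ cong (q ^_) (blanks+letters (F i)) ⟨
    q ^ (blanks (F i) + letters (F i))     ≡⟨ cong (q ^_) (+-comm (blanks (F i)) _) ⟩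
    q ^ (letters (F i) + blanks (F i))     ≡⟨ ^-distribˡ-+-* q (letters (F i)) _ ⟩
    q ^ letters (F i) * q ^ blanks (F i)   ∎
    where open ≡-Reasoning

  poor-share : ∀ i → 𝟙 (poor i) * (2 * q ^ n) ≤ s * (𝟙 (P i) * q ^ blanks (F i))
  poor-share i with P i | s ≤ᵇ 2 * q ^ letters (F i) | ≤ᵇ-reflects-≤ s (2 * q ^ letters (F i))
  ... | false | _     | _      = z≤n
  ... | true  | true  | _      = z≤n
  ... | true  | false | ofⁿ s≰ = begin
    2 * q ^ n + 0                                ≡⟨ +-identityʳ _ ⟩
    2 * q ^ n                                    ≡⟨ cong (2 *_) (q^n-split i) ⟩
    2 * (q ^ letters (F i) * q ^ blanks (F i))   ≡⟨ *-assoc 2 (q ^ letters (F i)) _ ⟨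
    2 * q ^ letters (F i) * q ^ blanks (F i)     ≤⟨ *-monoˡ-≤ (q ^ blanks (F i)) (<⇒≤ (≰⇒> s≰)) ⟩
    s * q ^ blanks (F i)                         ≡⟨ cong (s *_) (+-identityʳ _) ⟨
    s * (q ^ blanks (F i) + 0)                   ∎
    where open ≤-Reasoning

  few-poor : 2 * count poor ≤ s
  few-poor = *-cancelʳ-≤ (2 * count poor) s (q ^ n) {{m^n≢0 q n}} (begin
    2 * count poor * q ^ n                          ≡⟨ cong (_* q ^ n) (*-comm 2 (count poor)) ⟩
    count poor * 2 * q ^ n                          ≡⟨ *-assoc (count poor) 2 (q ^ n) ⟩
    count poor * (2 * q ^ n)                        ≡⟨ *-distribʳ-sum (2 * q ^ n) (𝟙 ∘ poor) ⟩
    ∑[ i < N ] (𝟙 (poor i) * (2 * q ^ n))           ≤⟨ sum-mono _ _ poor-share ⟩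
    ∑[ i < N ] (s * (𝟙 (P i) * q ^ blanks (F i)))   ≡⟨ *-distribˡ-sum s (λ i → 𝟙 (P i) * q ^ blanks (F i)) ⟨
    s * ∑[ i < N ] (𝟙 (P i) * q ^ blanks (F i))     ≤⟨ *-monoʳ-≤ s kraft-bound ⟩
    s * q ^ n                                       ∎)
    where open ≤-Reasoning

  many-rich : s ≤ 2 * count rich
  many-rich = +-cancelʳ-≤ (2 * count poor) s (2 * count rich) (begin
    s + 2 * count poor              ≤⟨ +-monoʳ-≤ s few-poor ⟩
    s + s                           ≡⟨ cong (s +_) (+-identityʳ s) ⟨
    2 * s                           ≡⟨ cong (2 *_) rich+poor ⟨
    2 * (count rich + count poor)   ≡⟨ *-distribˡ-+ 2 (count rich) (count poor) ⟩
    2 * count rich + 2 * count poor ∎)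
    where open ≤-Reasoning

  rich-product : s ^ count rich ≤ 2 ^ count rich * q ^ X
  rich-product = ≤-trans (power-bound rich (letters ∘ F) rich-bound)
    (*-monoʳ-≤ (2 ^ count rich) (^-monoʳ-≤ q (sum-mono _ _ (λ i → 𝟙-∧-≤ (P i) _ (letters (F i))))))
    where
    rich-bound : ∀ i → rich i ≡ true → s ≤ 2 * q ^ letters (F i)
    rich-bound i richᵢ with s ≤ᵇ 2 * q ^ letters (F i) | ≤ᵇ-reflects-≤ s (2 * q ^ letters (F i))
    ... | true  | ofʸ s≤ = s≤
    ... | false | _      with () ← Bool.∧-conicalʳ (P i) false richᵢ

  bound : s ^ s ≤ 2 ^ (2 * s) * q ^ (2 * X)
  bound = subst (λ B → s ^ s ≤ 2 ^ (2 * s) * B) (trans (^-*-assoc q X 2) (cong (q ^_) (*-comm X 2)))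
            (doubling-bound many-rich (subst (count rich ≤_) rich+poor (m≤m+n (count rich) _)) rich-product)

SamePair : {A : Set} → A → A → A → A → Set
SamePair x y u v = (x ≡ u × y ≡ v) ⊎ (x ≡ v × y ≡ u)

samePair-trans : {A : Set} {a b x y u v : A} → SamePair a b u v → SamePair x y u v → SamePair a b x y
samePair-trans (inj₁ (a≡u , b≡v)) (inj₁ (x≡u , y≡v)) = inj₁ (trans a≡u (sym x≡u) , trans b≡v (sym y≡v))
samePair-trans (inj₁ (a≡u , b≡v)) (inj₂ (x≡v , y≡u)) = inj₂ (trans a≡u (sym y≡u) , trans b≡v (sym x≡v))
samePair-trans (inj₂ (a≡v , b≡u)) (inj₁ (x≡u , y≡v)) = inj₂ (trans a≡v (sym y≡v) , trans b≡u (sym x≡u))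
samePair-trans (inj₂ (a≡v , b≡u)) (inj₂ (x≡v , y≡u)) = inj₁ (trans a≡v (sym x≡v) , trans b≡u (sym y≡u))

samePair-swap : {A : Set} {x y u v : A} → SamePair x y u v → SamePair y x u v
samePair-swap (inj₁ (x≡u , y≡v)) = inj₂ (y≡v , x≡u)
samePair-swap (inj₂ (x≡v , y≡u)) = inj₁ (y≡u , x≡v)

samePair-injective : {A B : Set} {f : A → B} → Injective _≡_ _≡_ f →
  ∀ {a b x y} → SamePair (f a) (f b) (f x) (f y) → SamePair a b x y
samePair-injective f-inj (inj₁ (p , q)) = inj₁ (f-inj p , f-inj q)
samePair-injective f-inj (inj₂ (p , q)) = inj₂ (f-inj p , f-inj q)

pair-test-false : ∀ {n} {x y i j : Fin n} → ¬ (x ≡ i × y ≡ j) → does (x ≟ i) ∧ does (y ≟ j) ≡ false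
pair-test-false {x = x} {y} {i} {j} ne with x ≟ i
... | no  _   = refl
... | yes x≡i = dec-false (y ≟ j) (λ y≡j → ne (x≡i , y≡j))

module _ {n t} (c : Colouring n t) (i j : Fin n) (a : Fin t) where

  addEdge-new : ∀ {x y} → SamePair x y i j → addEdge c i j a x y ≡ just a
  addEdge-new {x} {y} (inj₁ (x≡i , y≡j)) rewrite dec-true (x ≟ i) x≡i | dec-true (y ≟ j) y≡j = refl
  addEdge-new {x} {y} (inj₂ (x≡j , y≡i))
    rewrite dec-true (x ≟ j) x≡j | dec-true (y ≟ i) y≡i | Bool.∨-zeroʳ (does (x ≟ i) ∧ does (y ≟ j)) = refl

  addEdge-old : ∀ {x y} → ¬ SamePair x y i j → addEdge c i j a x y ≡ c x y
  addEdge-old ne rewrite pair-test-false (ne ∘ inj₁) | pair-test-false (ne ∘ inj₂) = refl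

transfer : ∀ {k n t} (H : SimpleGraph k) {c₁ c₂ : Colouring n t} (copy : RainbowCopy H c₁) →
  (ψ : Fin k → Fin n) → Injective _≡_ _≡_ ψ →
  (∀ x y → adj H x y ≡ true → c₂ (ψ x) (ψ y) ≡ c₁ (proj₁ copy x) (proj₁ copy y)) →
  RainbowCopy H c₂
transfer H (φ , φ-inj , coloured , rainbow) ψ ψ-inj agrees =
  ψ , ψ-inj ,
  (λ x y xy → proj₁ (coloured x y xy) , trans (agrees x y xy) (proj₂ (coloured x y xy))) ,
  (λ x y x′ y′ xy x′y′ same →
     rainbow x y x′ y′ xy x′y′ (trans (sym (agrees x y xy)) (trans same (agrees x′ y′ x′y′))))

module _ {k} (H : SimpleGraph k) where

  adj-sym : ∀ {x y} → adj H x y ≡ true → adj H y x ≡ true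
  adj-sym {x} {y} xy = trans (SimpleGraph.sym H y x) xy

  adj-≢ : ∀ {x y} → adj H x y ≡ true → x ≢ y
  adj-≢ {x} xy refl with () ← trans (sym xy) (SimpleGraph.irrefl H x)

  Conical : Fin k → Set
  Conical v = ∀ u → u ≢ v → adj H v u ≡ true

  PendantAt : Fin k → Fin k → Set
  PendantAt y x = ∀ h → h ≢ x → adj H y h ≡ false

  CommonNeighbour : Fin k → Fin k → Set
  CommonNeighbour x y = ∃[ h ] (adj H x h ≡ true × adj H y h ≡ true)

  conical-edge : ∀ {x y} → Conical x → adj H x y ≡ true → CommonNeighbour x y ⊎ PendantAt y x
  conical-edge {x} {y} conical xy with Fin.any? (λ h → ¬? (h ≟ x) ×-dec (adj H y h Bool.≟ true))
  ... | yes (h , h≢x , yh) = inj₁ (h , conical h h≢x , yh)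
  ... | no  none           = inj₂ (λ h h≢x → Bool.¬-not (λ yh → none (h , h≢x , yh)))

  edge-shape : ∀ {w} → Conical w → ∀ {x y} → adj H x y ≡ true →
    CommonNeighbour x y ⊎ (Conical x × PendantAt y x) ⊎ (Conical y × PendantAt x y)
  edge-shape {w} conical {x} {y} xy with w ≟ x | w ≟ y
  ... | yes refl | _ with conical-edge conical xy
  ...   | inj₁ common  = inj₁ common
  ...   | inj₂ pendant = inj₂ (inj₁ (conical , pendant))
  edge-shape {w} conical {x} {y} xy | no _ | yes refl with conical-edge conical (adj-sym xy)
  ...   | inj₁ (h , yh , xh) = inj₁ (h , xh , yh)
  ...   | inj₂ pendant       = inj₂ (inj₂ (conical , pendant))
  edge-shape {w} conical {x} {y} xy | no w≢x | no w≢y =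
    inj₁ (w , adj-sym (conical x (w≢x ∘ sym)) , adj-sym (conical y (w≢y ∘ sym)))

third-vertex : ∀ {k} → 3 ≤ k → (x y : Fin k) → ∃[ z ] (z ≢ x × z ≢ y)
third-vertex (s≤s (s≤s (s≤s _))) zero          zero          = suc zero , (λ ()) , (λ ())
third-vertex (s≤s (s≤s (s≤s _))) zero          (suc zero)    = suc (suc zero) , (λ ()) , (λ ())
third-vertex (s≤s (s≤s (s≤s _))) zero          (suc (suc _)) = suc zero , (λ ()) , (λ ())
third-vertex (s≤s (s≤s (s≤s _))) (suc zero)    zero          = suc (suc zero) , (λ ()) , (λ ())
third-vertex (s≤s (s≤s (s≤s _))) (suc zero)    (suc _)       = zero , (λ ()) , (λ ())
third-vertex (s≤s (s≤s (s≤s _))) (suc (suc _)) zero          = suc zero , (λ ()) , (λ ())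
third-vertex (s≤s (s≤s (s≤s _))) (suc (suc _)) (suc _)       = zero , (λ ()) , (λ ())

-- A graph on at least three vertices with a conical vertex has an edge, so t ≥ e(H) ≥ 1.
has-edge : ∀ {k} (H : SimpleGraph k) → 3 ≤ k → HasConicalVertex H → 1 ≤ eH H
has-edge {k} H k≥3 (w , conical) = half (begin
  1                                        ≡⟨ cong 𝟙 (conical z z≢w) ⟨
  𝟙 (adj H w z)                            ≤⟨ term≤sum (λ j → 𝟙 (adj H w j)) z ⟩
  ∑[ j < k ] 𝟙 (adj H w j)                 ≤⟨ term≤sum (λ i → ∑[ j < k ] 𝟙 (adj H i j)) w ⟩
  ∑[ i < k ] ∑[ j < k ] 𝟙 (adj H i j)      ≡⟨ handshake k (adj H) (SimpleGraph.sym H) (SimpleGraph.irrefl H) ⟩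
  2 * eH H                                 ∎)
  where
  open ≤-Reasoning
  z : Fin k
  z = proj₁ (third-vertex k≥3 w w)
  z≢w : z ≢ w
  z≢w = proj₁ (proj₂ (third-vertex k≥3 w w))
  half : ∀ {e} → 1 ≤ 2 * e → 1 ≤ e
  half {zero}  ()
  half {suc _} _ = s≤s z≤n

module _ {n t} (G : ColGraph n t) where

  col-sym : ∀ {x y} → col G x y ≡ col G y x
  col-sym {x} {y} = ColGraph.sym G x y

  Sees : Fin n → Fin t → Set
  Sees u a = (∃[ p ] col G u p ≡ just a) ⊎ (∀ z → col G u z ≡ nothing)

  -- The word of u records the colours of the edges at u, and a fresh letter at u itself.
  code : Fin n → Word n (suc t)
  code u z with z ≟ u
  ... | yes _ = just (fromℕ t)
  ... | no  _ = Maybe.map inject₁ (col G u z)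

  code-self : ∀ u → code u u ≡ just (fromℕ t)
  code-self u with u ≟ u
  ... | yes _   = refl
  ... | no  u≢u = ⊥-elim (u≢u refl)

  code-edge : ∀ {u z α} → z ≢ u → col G u z ≡ just α → code u z ≡ just (inject₁ α)
  code-edge {u} {z} z≢u uz with z ≟ u
  ... | yes z≡u = ⊥-elim (z≢u z≡u)
  ... | no  _   rewrite uz = refl

  degree : Fin n → ℕ
  degree u = ∑[ z < n ] 𝟙 (is-just (col G u z))

  letters-code : ∀ u → letters (code u) ≡ 1 + degree u
  letters-code u = begin
    ∑[ z < n ] 𝟙 (is-just (code u z))                                  ≡⟨ sum-cong-≗ split ⟩
    ∑[ z < n ] (𝟙 (does (z ≟ u)) + 𝟙 (is-just (col G u z)))
      ≡⟨ ∑-distrib-+ (λ z → 𝟙 (does (z ≟ u))) (λ z → 𝟙 (is-just (col G u z))) ⟩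
    count (λ z → does (z ≟ u)) + ∑[ z < n ] 𝟙 (is-just (col G u z))   ≡⟨ cong (_+ degree u) (count-≡ u) ⟩
    1 + degree u                                                       ∎
    where
    open ≡-Reasoning
    split : ∀ z → 𝟙 (is-just (code u z)) ≡ 𝟙 (does (z ≟ u)) + 𝟙 (is-just (col G u z))
    split z with z ≟ u
    ... | yes refl rewrite ColGraph.irrefl G z = refl
    ... | no  _    with col G u z
    ...   | just _  = refl
    ...   | nothing = refl

sees? : ∀ {n t} (G : ColGraph n (suc t)) u → ∃ (Sees G u)
sees? G u with Fin.any? (λ z → is-just (col G u z) Bool.≟ true)
... | yes (z , uz) = seen (col G u z) refl uz
  where
  seen : ∀ m → col G u z ≡ m → is-just m ≡ true → ∃ (Sees G u)
  seen (just c) uz≡c _ = c , inj₁ (z , uz≡c)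
... | no  none     = zero , inj₂ (λ z → absent (col G u z) (λ uz → none (z , uz)))
  where
  absent : ∀ {A : Set} (m : Maybe A) → is-just m ≢ true → m ≡ nothing
  absent (just _) not-just = ⊥-elim (not-just refl)
  absent nothing  _        = refl

module NewEdgeCopy {k n t} (H : SimpleGraph k) (G : ColGraph n t) {u v : Fin n} {a : Fin t}
  (u≢v : u ≢ v) (uv∉G : col G u v ≡ nothing) (copy : RainbowCopy H (addEdge (col G) u v a)) where

  c′ : Colouring n t
  c′ = addEdge (col G) u v a

  φ : Fin k → Fin n
  φ = proj₁ copy

  φ-inj : Injective _≡_ _≡_ φ
  φ-inj = proj₁ (proj₂ copy)

  coloured : ∀ x y → adj H x y ≡ true → ∃[ α ] (c′ (φ x) (φ y) ≡ just α)
  coloured = proj₁ (proj₂ (proj₂ copy))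

  rainbow : ∀ x y x′ y′ → adj H x y ≡ true → adj H x′ y′ ≡ true →
    c′ (φ x) (φ y) ≡ c′ (φ x′) (φ y′) → SamePair x y x′ y′
  rainbow = proj₂ (proj₂ (proj₂ copy))

  absent : ∀ {p q} → SamePair p q u v → col G p q ≡ nothing
  absent (inj₁ (refl , refl)) = uv∉G
  absent (inj₂ (refl , refl)) = trans (col-sym G) uv∉G

  away : ∀ {p z} → z ≢ u → z ≢ v → c′ p z ≡ col G p z
  away z≢u z≢v = addEdge-old (col G) u v a λ { (inj₁ (_ , z≡v)) → z≢v z≡v ; (inj₂ (_ , z≡u)) → z≢u z≡u }

  avoids : ∀ {x y h} → SamePair (φ x) (φ y) u v → h ≢ x → h ≢ y → φ h ≢ u × φ h ≢ v
  avoids (inj₁ (φx≡u , φy≡v)) h≢x h≢y = h≢x ∘ φ-inj ∘ (λ e → trans e (sym φx≡u)) , h≢y ∘ φ-inj ∘ (λ e → trans e (sym φy≡v))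
  avoids (inj₂ (φx≡v , φy≡u)) h≢x h≢y = h≢y ∘ φ-inj ∘ (λ e → trans e (sym φy≡u)) , h≢x ∘ φ-inj ∘ (λ e → trans e (sym φx≡v))

  uses-new-edge : ¬ RainbowCopy H (col G) → ∃[ x ] ∃[ y ] (adj H x y ≡ true × φ x ≡ u × φ y ≡ v)
  uses-new-edge no-copy
    with Fin.any? (λ x → Fin.any? (λ y → (adj H x y Bool.≟ true) ×-dec ((φ x ≟ u) ×-dec (φ y ≟ v))))
  ... | yes found = found
  ... | no  none  = ⊥-elim (no-copy (transfer H {c₁ = c′} {c₂ = col G} copy φ φ-inj agrees))
    where
    agrees : ∀ x y → adj H x y ≡ true → col G (φ x) (φ y) ≡ c′ (φ x) (φ y)
    agrees x y xy = sym (addEdge-old (col G) u v a λ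
      { (inj₁ (φx≡u , φy≡v)) → none (x , y , xy , φx≡u , φy≡v)
      ; (inj₂ (φx≡v , φy≡u)) → none (y , x , adj-sym H xy , φy≡u , φx≡v) })

  -- a common neighbour h of x and y is joined to u and v by edges of different colours
  common-neighbour-conflict : ∀ {x y} → φ x ≡ u → φ y ≡ v → CommonNeighbour H x y →
    Conflict (code G u) (code G v)
  common-neighbour-conflict {x} {y} φx≡u φy≡v (h , xh , yh) =
    φ h , inject₁ α , inject₁ β ,
    code-edge G (proj₁ off) (old-colour φx≡u (proj₂ (coloured x h xh))) ,
    code-edge G (proj₂ off) (old-colour φy≡v (proj₂ (coloured y h yh))) ,
    α≢β ∘ Fin.inject₁-injective
    where
    h≢x : h ≢ x
    h≢x = adj-≢ H xh ∘ sym
    off : φ h ≢ u × φ h ≢ v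
    off = avoids (inj₁ (φx≡u , φy≡v)) h≢x (adj-≢ H yh ∘ sym)
    α β : Fin t
    α = proj₁ (coloured x h xh)
    β = proj₁ (coloured y h yh)
    old-colour : ∀ {z p γ} → φ z ≡ p → c′ (φ z) (φ h) ≡ just γ → col G p (φ h) ≡ just γ
    old-colour refl zh = trans (sym (away (proj₁ off) (proj₂ off))) zh
    α≢β : α ≢ β
    α≢β α≡β with rainbow x h y h xh yh
                   (trans (proj₂ (coloured x h xh)) (trans (cong just α≡β) (sym (proj₂ (coloured y h yh)))))
    ... | inj₁ (x≡y , _) = u≢v (trans (sym φx≡u) (trans (cong φ x≡y) φy≡v))
    ... | inj₂ (x≡h , _) = h≢x (sym x≡h)

  -- if the new edge is the image of a pendant edge xy at a conical vertex x, move y to the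
  -- other end p of an edge xp of colour a: this gives a rainbow copy inside G
  reroute-pendant : ∀ {x y} → 3 ≤ k → adj H x y ≡ true → Conical H x → PendantAt H y x →
    SamePair (φ x) (φ y) u v → Sees G (φ x) a → RainbowCopy H (col G)
  reroute-pendant {x} {y} k≥3 xy conical pendant new sees = transfer H {c₁ = c′} {c₂ = col G} copy ψ ψ-inj agrees
    where
    z : Fin k
    z = proj₁ (third-vertex k≥3 x y)
    z≢x : z ≢ x
    z≢x = proj₁ (proj₂ (third-vertex k≥3 x y))
    z-off : φ z ≢ u × φ z ≢ v
    z-off = avoids new z≢x (proj₂ (proj₂ (third-vertex k≥3 x y)))

    -- φ x is not isolated in G, so it sees a on some edge
    a-edge : Sees G (φ x) a → ∃[ p ] col G (φ x) p ≡ just a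
    a-edge (inj₁ found)    = found
    a-edge (inj₂ isolated)
      with () ← trans (sym (isolated (φ z)))
                      (trans (sym (away (proj₁ z-off) (proj₂ z-off))) (proj₂ (coloured x z (conical z z≢x))))
    p : Fin n
    p = proj₁ (a-edge sees)
    xp : col G (φ x) p ≡ just a
    xp = proj₂ (a-edge sees)

    -- p is not on the copy: not φ x (no loops), not φ y (the new pair is absent from G), and no
    -- other φ h, for then the copy would have two edges of colour a at φ x
    p-new : ∀ h → φ h ≢ p
    p-new h φh≡p with h ≟ x | h ≟ y
    ... | yes refl | _        with () ← trans (sym (ColGraph.irrefl G (φ h))) (subst (λ q → col G (φ h) q ≡ just a) (sym φh≡p) xp)
    ... | no _     | yes refl with () ← trans (sym (absent new)) (subst (λ q → col G (φ x) q ≡ just a) (sym φh≡p) xp)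
    ... | no h≢x   | no h≢y   with rainbow x h x y (conical h h≢x) xy (begin
          c′ (φ x) (φ h)     ≡⟨ away (proj₁ (avoids new h≢x h≢y)) (proj₂ (avoids new h≢x h≢y)) ⟩
          col G (φ x) (φ h)  ≡⟨ cong (col G (φ x)) φh≡p ⟩
          col G (φ x) p      ≡⟨ xp ⟩
          just a             ≡⟨ addEdge-new (col G) u v a new ⟨
          c′ (φ x) (φ y)     ∎)
      where open ≡-Reasoning
    ...   | inj₁ (_ , h≡y) = h≢y h≡y
    ...   | inj₂ (x≡y , _) = adj-≢ H xy x≡y

    ψ : Fin k → Fin n
    ψ h with h ≟ y
    ... | yes _ = p
    ... | no  _ = φ h

    ψ-inj : Injective _≡_ _≡_ ψ
    ψ-inj {h₁} {h₂} eq with h₁ ≟ y | h₂ ≟ y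
    ... | yes h₁≡y | yes h₂≡y = trans h₁≡y (sym h₂≡y)
    ... | yes _    | no  _    = ⊥-elim (p-new h₂ (sym eq))
    ... | no  _    | yes _    = ⊥-elim (p-new h₁ eq)
    ... | no  _    | no  _    = φ-inj eq

    agrees : ∀ h₁ h₂ → adj H h₁ h₂ ≡ true → col G (ψ h₁) (ψ h₂) ≡ c′ (φ h₁) (φ h₂)
    agrees h₁ h₂ h₁h₂ with h₁ ≟ y | h₂ ≟ y
    ... | yes refl | yes refl = ⊥-elim (adj-≢ H h₁h₂ refl)
    ... | yes refl | no _ with h₂ ≟ x
    ...   | yes refl = trans (col-sym G) (trans xp (sym (addEdge-new (col G) u v a (samePair-swap new))))
    ...   | no h₂≢x  with () ← trans (sym h₁h₂) (pendant h₂ h₂≢x)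
    agrees h₁ h₂ h₁h₂ | no _ | yes refl with h₁ ≟ x
    ...   | yes refl = trans xp (sym (addEdge-new (col G) u v a new))
    ...   | no h₁≢x  with () ← trans (sym (adj-sym H h₁h₂)) (pendant h₁ h₁≢x)
    agrees h₁ h₂ h₁h₂ | no h₁≢y | no h₂≢y = sym (addEdge-old (col G) u v a off-pair)
      where
      off-pair : ¬ SamePair (φ h₁) (φ h₂) u v
      off-pair same with samePair-injective φ-inj (samePair-trans same new)
      ... | inj₁ (_ , h₂≡y) = h₂≢y h₂≡y
      ... | inj₂ (h₁≡y , _) = h₁≢y h₁≡y

-- In a saturated graph, two vertices seeing a common colour have conflicting words:
-- either they are adjacent, or saturation yields a rainbow copy through the new edge uv,
-- which (H having a conical vertex) gives a common neighbour of u and v seen in two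
-- different colours; the remaining pendant case contradicts the absence of rainbow copies.
saturated-conflict : ∀ {k n t} (H : SimpleGraph k) (G : ColGraph n t) {w} → Conical H w → 3 ≤ k →
  Saturated H G → ∀ {u v a} → u ≢ v → Sees G u a → Sees G v a → Conflict (code G u) (code G v)
saturated-conflict {t = t} H G conical k≥3 (no-copy , saturated) {u} {v} {a} u≢v sees-u sees-v
  with col G u v in uv
... | just c  = u , fromℕ t , inject₁ c , code-self G u , code-edge G u≢v (trans (col-sym G) uv) , Fin.fromℕ≢inject₁
... | nothing = through-new-edge (uses-new-edge no-copy)
  where
  open NewEdgeCopy H G u≢v uv (saturated u v u≢v uv a)
  seen : ∀ {p q} → p ≡ q → Sees G q a → Sees G p a
  seen refl sees = sees
  through-new-edge : ∃[ x ] ∃[ y ] (adj H x y ≡ true × φ x ≡ u × φ y ≡ v) → Conflict (code G u) (code G v)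
  through-new-edge (x , y , xy , φx≡u , φy≡v) with edge-shape H conical xy
  ... | inj₁ common = common-neighbour-conflict φx≡u φy≡v common
  ... | inj₂ (inj₁ (conical-x , pendant-y)) =
    ⊥-elim (no-copy (reroute-pendant k≥3 xy conical-x pendant-y (inj₁ (φx≡u , φy≡v)) (seen φx≡u sees-u)))
  ... | inj₂ (inj₂ (conical-y , pendant-x)) =
    ⊥-elim (no-copy (reroute-pendant k≥3 (adj-sym H xy) conical-y pendant-x (inj₂ (φy≡v , φx≡u)) (seen φy≡v sees-v)))

-- In a saturated graph G with t + 1 colours, the vertices seeing a most popular colour have
-- pairwise conflicting words, so Kraft's inequality and the entropy bound apply to them.
module SaturatedCounting {k n t} (H : SimpleGraph k) {w} (conical : Conical H w) (k≥3 : 3 ≤ k)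
  (G : ColGraph n (suc t)) (saturated : Saturated H G) where

  colour : Fin n → Fin (suc t)
  colour u = proj₁ (sees? G u)

  a : Fin (suc t)
  a = proj₁ (pigeonhole colour)

  selected : Fin n → Bool
  selected u = does (a ≟ colour u)

  s X : ℕ
  s = count selected
  X = ∑[ u < n ] (𝟙 (selected u) * letters (code G u))

  many-selected : n ≤ suc t * s
  many-selected = proj₂ (pigeonhole colour)

  selected-sees : ∀ u → selected u ≡ true → Sees G u a
  selected-sees u sel with a ≟ colour u
  ... | yes a≡colour = subst (Sees G u) (sym a≡colour) (proj₂ (sees? G u))

  entropy : s ^ s ≤ 2 ^ (2 * s) * suc (suc t) ^ (2 * X)
  entropy = entropy-bound (code G) selected (kraft n (code G) selected conflicting)
    where
    conflicting : ∀ u v → selected u ≡ true → selected v ≡ true → u ≢ v → Conflict (code G u) (code G v)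
    conflicting u v sel-u sel-v u≢v =
      saturated-conflict H G conical k≥3 saturated u≢v (selected-sees u sel-u) (selected-sees v sel-v)

  -- every selected word has one letter per edge at its vertex, plus one
  few-letters : X ≤ n + 2 * eG G
  few-letters = begin
    X                                ≤⟨ sum-mono _ _ (λ u → 𝟙-*-≤ (selected u) (letters (code G u))) ⟩
    ∑[ u < n ] letters (code G u)    ≡⟨ sum-cong-≗ (letters-code G) ⟩
    ∑[ u < n ] (1 + degree G u)      ≡⟨ ∑-distrib-+ (λ _ → 1) (degree G) ⟩
    ∑[ u < n ] 1 + sum (degree G)    ≡⟨ cong₂ _+_ (trans (sum-const n 1) (*-identityʳ n)) degree-sum ⟩
    n + 2 * eG G                     ∎
    where
    open ≤-Reasoning
    degree-sum : sum (degree G) ≡ 2 * eG G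
    degree-sum = handshake n _ (λ i j → cong is-just (col-sym G)) (λ i → cong is-just (ColGraph.irrefl G i))

growth-bound : ∀ t n s X e → n ≤ t * s → s ≤ n → X ≤ n + 2 * e →
  s ^ s ≤ 2 ^ (2 * s) * suc t ^ (2 * X) → n ^ n ≤ 2 ^ ((3 * t + 2 * t * t) * n + 4 * t * t * e)
growth-bound t zero zero X e _ _ _ _ = m^n>0 2 ((3 * t + 2 * t * t) * 0 + 4 * t * t * e)
growth-bound t (suc n) zero X e n≤ts _ _ _ with () ← ≤-trans n≤ts (≤-reflexive (*-zeroʳ t))
growth-bound t n s@(suc _) X e n≤ts s≤n X≤ entropy = begin
  n ^ n                          ≤⟨ ^-monoˡ-≤ n n≤ts ⟩
  (t * s) ^ n                    ≡⟨ ^-distribʳ-* t s n ⟩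
  t ^ n * s ^ n                  ≤⟨ *-mono-≤ t^n s^n ⟩
  2 ^ (t * n) * 2 ^ (E * t)      ≡⟨ ^-distribˡ-+-* 2 (t * n) (E * t) ⟨
  2 ^ (t * n + E * t)            ≡⟨ cong (2 ^_) (exponent t n e) ⟩
  2 ^ ((3 * t + 2 * t * t) * n + 4 * t * t * e) ∎
  where
  open ≤-Reasoning
  E : ℕ
  E = 2 * n + t * (2 * (n + 2 * e))
  exponent : ∀ t n e → t * n + (2 * n + t * (2 * (n + 2 * e))) * t ≡ (3 * t + 2 * t * t) * n + 4 * t * t * e
  exponent = solve 3 (λ t n e → t :* n :+ (con 2 :* n :+ t :* (con 2 :* (n :+ con 2 :* e))) :* t
                       := (con 3 :* t :+ con 2 :* t :* t) :* n :+ con 4 :* t :* t :* e) refl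
    where open +-*-Solver
  t^n : t ^ n ≤ 2 ^ (t * n)
  t^n = ≤-trans (^-monoˡ-≤ n (≤-trans (n≤1+n t) (suc≤2^ t))) (≤-reflexive (^-*-assoc 2 t n))
  s^s : s ^ s ≤ 2 ^ E
  s^s = begin
    s ^ s                              ≤⟨ entropy ⟩
    2 ^ (2 * s) * suc t ^ (2 * X)      ≤⟨ *-monoʳ-≤ (2 ^ (2 * s)) (^-monoˡ-≤ (2 * X) (suc≤2^ t)) ⟩
    2 ^ (2 * s) * (2 ^ t) ^ (2 * X)    ≡⟨ cong (2 ^ (2 * s) *_) (^-*-assoc 2 t (2 * X)) ⟩
    2 ^ (2 * s) * 2 ^ (t * (2 * X))    ≡⟨ ^-distribˡ-+-* 2 (2 * s) (t * (2 * X)) ⟨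
    2 ^ (2 * s + t * (2 * X))          ≤⟨ ^-monoʳ-≤ 2 (+-mono-≤ (*-monoʳ-≤ 2 s≤n) (*-monoʳ-≤ t (*-monoʳ-≤ 2 X≤))) ⟩
    2 ^ E                              ∎
  s^n : s ^ n ≤ 2 ^ (E * t)
  s^n = begin
    s ^ n          ≤⟨ ^-monoʳ-≤ s (≤-trans n≤ts (≤-reflexive (*-comm t s))) ⟩
    s ^ (s * t)    ≡⟨ ^-*-assoc s s t ⟨
    (s ^ s) ^ t    ≤⟨ ^-monoˡ-≤ t s^s ⟩
    (2 ^ E) ^ t    ≡⟨ ^-*-assoc 2 E t ⟩
    2 ^ (E * t)    ∎

-- Raising n ^ n ≤ 2 ^ (B n + T e) to the power m and absorbing 2 ^ (B m n) ≤ n ^ n ≤ n ^ (T n)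
-- (valid once n ≥ 2 ^ (B m)) leaves n ^ ((m - T) n) ≤ 2 ^ (T m e).
trade-powers : ∀ B T n e m → 1 ≤ T → 2 ^ (B * m) ≤ n → n ^ n ≤ 2 ^ (B * n + T * e) →
  n ^ ((m ∸ T) * n) ≤ 2 ^ (T * m * e)
trade-powers B T zero e m _ 2^≤0 _ with () ← ≤-trans (m^n>0 2 (B * m)) 2^≤0
trade-powers B T n@(suc _) e m 1≤T 2^≤n n^n≤ with m ≤? T
... | yes m≤T rewrite m≤n⇒m∸n≡0 m≤T = m^n>0 2 (T * m * e)
... | no  m≰T = *-cancelʳ-≤ (n ^ (r * n)) (2 ^ (T * m * e)) (n ^ (T * n)) {{m^n≢0 n (T * n)}} (begin
  n ^ (r * n) * n ^ (T * n)               ≡⟨ ^-distribˡ-+-* n (r * n) (T * n) ⟨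
  n ^ (r * n + T * n)                     ≡⟨ cong (n ^_) exponent ⟩
  n ^ (n * m)                             ≡⟨ ^-*-assoc n n m ⟨
  (n ^ n) ^ m                             ≤⟨ ^-monoˡ-≤ m n^n≤ ⟩
  (2 ^ (B * n + T * e)) ^ m               ≡⟨ ^-*-assoc 2 (B * n + T * e) m ⟩
  2 ^ ((B * n + T * e) * m)               ≡⟨ cong (2 ^_) (regroup B n T e m) ⟩
  2 ^ (B * m * n + T * m * e)             ≡⟨ ^-distribˡ-+-* 2 (B * m * n) (T * m * e) ⟩
  2 ^ (B * m * n) * 2 ^ (T * m * e)       ≤⟨ *-monoˡ-≤ (2 ^ (T * m * e)) absorbed ⟩
  n ^ (T * n) * 2 ^ (T * m * e)           ≡⟨ *-comm (n ^ (T * n)) _ ⟩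
  2 ^ (T * m * e) * n ^ (T * n)           ∎)
  where
  open ≤-Reasoning
  r : ℕ
  r = m ∸ T
  exponent : r * n + T * n ≡ n * m
  exponent = trans (sym (*-distribʳ-+ n r T)) (trans (cong (_* n) (m∸n+n≡m (<⇒≤ (≰⇒> m≰T)))) (*-comm m n))
  regroup : ∀ B n T e m → (B * n + T * e) * m ≡ B * m * n + T * m * e
  regroup = solve 5 (λ B n T e m → (B :* n :+ T :* e) :* m := B :* m :* n :+ T :* m :* e) refl
    where open +-*-Solver
  absorbed : 2 ^ (B * m * n) ≤ n ^ (T * n)
  absorbed = begin
    2 ^ (B * m * n)    ≡⟨ ^-*-assoc 2 (B * m) n ⟨
    (2 ^ (B * m)) ^ n  ≤⟨ ^-monoˡ-≤ n 2^≤n ⟩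
    n ^ n              ≤⟨ ^-monoʳ-≤ n (m≤n*m n T {{>-nonZero 1≤T}}) ⟩
    n ^ (T * n)        ∎

saturated-bound : ∀ {k n t} (H : SimpleGraph k) → 3 ≤ k → HasConicalVertex H → 1 ≤ t →
  (G : ColGraph n t) → Saturated H G → n ^ n ≤ 2 ^ ((3 * t + 2 * t * t) * n + 4 * t * t * eG G)
saturated-bound {n = n} {t = suc t′} H k≥3 (w , conical) (s≤s z≤n) G saturated =
  growth-bound (suc t′) n s X (eG G) many-selected (count≤ selected) few-letters entropy
  where open SaturatedCounting H conical k≥3 G saturated

theorem2p3 : ∀ {k} (H : SimpleGraph k) → 3 ≤ k → HasConicalVertex H
    → ∀ (t : ℕ) → eH H ≤ t
    → ∀ (m : ℕ) → 1 ≤ m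
    → ∃[ N ] (∀ (n : ℕ) → N ≤ n → ∀ (G : ColGraph n t) → Saturated H G
        → n ^ ((m ∸ 4 * t * t) * n) ≤ 2 ^ (4 * t * t * m * eG G))
theorem2p3 H k≥3 conical-vertex t eH≤t m _ =
  2 ^ ((3 * t + 2 * t * t) * m) , λ n N≤n G saturated →
    trade-powers (3 * t + 2 * t * t) (4 * t * t) n (eG G) m 1≤4t² N≤n
      (saturated-bound H k≥3 conical-vertex 1≤t G saturated)
  where
  1≤t : 1 ≤ t
  1≤t = ≤-trans (has-edge H k≥3 conical-vertex) eH≤t
  1≤4t² : 1 ≤ 4 * t * t
  1≤4t² = *-mono-≤ (*-mono-≤ {1} {4} (s≤s z≤n) 1≤t) 1≤t
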